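{- For every simple planar graph $G$, there exists a planar multigraph $M_G$ with the same number of vertices as $G$ such that $a(M_G)=\alpha(G)$.
   Context: Multigraphs are finite, may have parallel edges, but have no loops. For a (multi)graph $G$, $a(G)$ denotes the maximum number of vertices of an induced forest in $G$ (a $2$-cycle formed by two parallel edges counts as a cycle). $\alpha(G)$ denotes the independence number of $G$. -}

module Defs where

open import Data.Nat as ℕ using (ℕ; zero; suc; _+_)
open import Data.Fin using (Fin; inject₁; fromℕ) renaming (zero to fzero; suc to fsuc)
open import Data.Fin.Subset using (Subset; _∈_; ∣_∣)
open import Data.Bool using (Bool; true; false)
open import Data.Product using (Σ; ∃; _×_; _,_)
open import Data.Sum using (_⊎_)
open import Data.Rational as ℚ using (ℚ; 0ℚ; 1ℚ)
open import Relation.Binary.PropositionalEquality using (_≡_; _≢_)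
open import Relation.Nullary using (¬_)
open import Function.Definitions using (Injective)

record SimpleGraph (n : ℕ) : Set where
  field
    adj    : Fin n → Fin n → Bool
    sym    : ∀ u v → adj u v ≡ adj v u
    irrefl : ∀ v → adj v v ≡ false

record Multigraph (n : ℕ) : Set where
  field
    mult     : Fin n → Fin n → ℕ
    sym      : ∀ u v → mult u v ≡ mult v u
    loopless : ∀ v → mult v v ≡ 0

-- Planarity (for an edge relation on Fin n):
-- existence of a straight-line plane drawing with rational coordinates.

Point : Set
Point = ℚ × ℚ

OnSegment : Point → Point → Point → Set
OnSegment (px , py) (ax , ay) (bx , by) =
  Σ ℚ λ t → (0ℚ ℚ.≤ t) × (t ℚ.≤ 1ℚ)
    × (px ≡ ax ℚ.+ t ℚ.* (bx ℚ.- ax))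
    × (py ≡ ay ℚ.+ t ℚ.* (by ℚ.- ay))

record PlaneDrawing {n : ℕ} (E : Fin n → Fin n → Set) : Set where
  field
    pos       : Fin n → Point
    pos-inj   : Injective _≡_ _≡_ pos
    vertex-off : ∀ u v w → E u v → w ≢ u → w ≢ v →
                 ¬ OnSegment (pos w) (pos u) (pos v)
    edges-meet : ∀ u v x y → E u v → E x y →
                 ¬ (u ≡ x × v ≡ y) → ¬ (u ≡ y × v ≡ x) →
                 ∀ p → OnSegment p (pos u) (pos v) → OnSegment p (pos x) (pos y) →
                 Σ (Fin n) λ z → (z ≡ u ⊎ z ≡ v) × (z ≡ x ⊎ z ≡ y) × (p ≡ pos z)

PlanarRel : {n : ℕ} → (Fin n → Fin n → Set) → Set
PlanarRel E = PlaneDrawing E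

PlanarGraph : {n : ℕ} → SimpleGraph n → Set
PlanarGraph G = PlanarRel (λ u v → SimpleGraph.adj G u v ≡ true)

-- A multigraph is planar iff its underlying simple graph is
-- (parallel edges can be drawn as nearby parallel curves).
PlanarMultigraph : {n : ℕ} → Multigraph n → Set
PlanarMultigraph M = PlanarRel (λ u v → 0 ℕ.< Multigraph.mult M u v)

Independent : {n : ℕ} → SimpleGraph n → Subset n → Set
Independent G S = ∀ u v → u ∈ S → v ∈ S → SimpleGraph.adj G u v ≡ false

IsIndependenceNumber : {n : ℕ} → SimpleGraph n → ℕ → Set
IsIndependenceNumber G k =
  (Σ _ λ S → Independent G S × ∣ S ∣ ≡ k)
  × (∀ S → Independent G S → ∣ S ∣ ℕ.≤ k)

record LongCycleIn {n : ℕ} (M : Multigraph n) (S : Subset n) : Set where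
  field
    m     : ℕ
    f     : Fin (3 + m) → Fin n
    f-inj : Injective _≡_ _≡_ f
    f-in  : ∀ i → f i ∈ S
    step  : ∀ (i : Fin (2 + m)) → 0 ℕ.< Multigraph.mult M (f (inject₁ i)) (f (fsuc i))
    close : 0 ℕ.< Multigraph.mult M (f (fromℕ (2 + m))) (f fzero)

-- The sub-multigraph induced by S is a forest: no 2-cycle (pair of
-- parallel edges) and no cycle of length ≥ 3.
InducedForest : {n : ℕ} → Multigraph n → Subset n → Set
InducedForest M S =
  (∀ u v → u ∈ S → v ∈ S → Multigraph.mult M u v ℕ.≤ 1)
  × ¬ LongCycleIn M S

IsForestNumber : {n : ℕ} → Multigraph n → ℕ → Set
IsForestNumber M k =
  (Σ _ λ S → InducedForest M S × ∣ S ∣ ≡ k)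
  × (∀ S → InducedForest M S → ∣ S ∣ ℕ.≤ k)

{-# OPTIONS --safe #-}
-- Doubling every edge of G keeps it planar and turns each edge into a 2-cycle,
-- so an induced forest of the doubled multigraph cannot contain any edge: its
-- induced forests are exactly the independent sets of G, whence a = α.
module Submission where

open import Defs
open import Data.Nat using (ℕ; zero; suc; _≤_; _<_; _≤?_; z≤n; s≤s)
open import Data.Nat.Properties using (≤-antisym; ≮⇒≥; n≤0⇒n≡0; n≮n)
open import Data.Fin using (Fin) renaming (zero to fzero; suc to fsuc)
open import Data.Fin.Properties using (all?)
open import Data.Fin.Subset using (Subset; _∈_; ∣_∣; ⊥)
open import Data.Fin.Subset.Properties using (anySubset?; _∈?_; ∣p∣≤n; ∉⊥)
open import Data.Bool using (true; false; if_then_else_)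
open import Data.Bool.Properties using () renaming (_≟_ to _≟ᵇ_)
open import Data.Product using (Σ; ∃; _×_; _,_)
open import Data.Empty using (⊥-elim)
open import Function using (_∘_)
open import Level using (0ℓ)
open import Relation.Binary.Core using (_⇒_)
open import Relation.Binary.PropositionalEquality using (_≡_; refl; cong; subst)
open import Relation.Nullary using (yes; no; ¬_)
open import Relation.Nullary.Decidable using (_→-dec_; _×-dec_)
open import Relation.Unary using (Pred; Decidable; _⊆_)

-- IsForestNumber M and IsIndependenceNumber G are definitionally IsMaximumSize
-- of InducedForest M and of Independent G.
IsMaximumSize : ∀ {n} → Pred (Subset n) 0ℓ → ℕ → Set
IsMaximumSize P k = (Σ _ λ S → P S × ∣ S ∣ ≡ k) × (∀ S → P S → ∣ S ∣ ≤ k)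

IsMaximumSize-cong : ∀ {n} {P Q : Pred (Subset n) 0ℓ} {k} →
                     P ⊆ Q → Q ⊆ P → IsMaximumSize P k → IsMaximumSize Q k
IsMaximumSize-cong P⊆Q Q⊆P ((S , PS , ∣S∣≡k) , bound) =
  (S , P⊆Q PS , ∣S∣≡k) , λ T QT → bound T (Q⊆P QT)

module _ {n} {P : Pred (Subset n) 0ℓ} (P? : Decidable P) {S₀ : Subset n} (PS₀ : P S₀) where

  maximumSize-below : ∀ k → (∀ S → P S → ∣ S ∣ ≤ k) → ∃ (IsMaximumSize P)
  maximumSize-below zero bound = zero , (S₀ , PS₀ , n≤0⇒n≡0 (bound S₀ PS₀)) , bound
  maximumSize-below (suc k) bound
    with anySubset? (λ S → P? S ×-dec (suc k ≤? ∣ S ∣))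
  ... | yes (S , PS , k<∣S∣) = suc k , (S , PS , ≤-antisym (bound S PS) k<∣S∣) , bound
  ... | no none = maximumSize-below k λ S PS → ≮⇒≥ λ k<∣S∣ → none (S , PS , k<∣S∣)

  maximumSize-exists : ∃ (IsMaximumSize P)
  maximumSize-exists = maximumSize-below n λ S _ → ∣p∣≤n S

PlanarRel-mono : ∀ {n} {E F : Fin n → Fin n → Set} → E ⇒ F → PlanarRel F → PlanarRel E
PlanarRel-mono E⇒F D = record
  { pos        = pos
  ; pos-inj    = pos-inj
  ; vertex-off = λ u v w e → vertex-off u v w (E⇒F e)
  ; edges-meet = λ u v x y e f → edges-meet u v x y (E⇒F e) (E⇒F f)
  }
  where open PlaneDrawing D

Edgeless : ∀ {n} → Multigraph n → Subset n → Set
Edgeless M S = ∀ {u v} → u ∈ S → v ∈ S → Multigraph.mult M u v ≡ 0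

edgeless⇒inducedForest : ∀ {n} {M : Multigraph n} {S} → Edgeless M S → InducedForest M S
edgeless⇒inducedForest {M = M} {S} edgeless = atMostOne , noCycle
  where
  atMostOne : ∀ u v → u ∈ S → v ∈ S → Multigraph.mult M u v ≤ 1
  atMostOne u v u∈S v∈S rewrite edgeless u∈S v∈S = z≤n

  noCycle : ¬ LongCycleIn M S
  noCycle C = n≮n 0 (subst (0 <_) (edgeless (f-in fzero) (f-in (fsuc fzero))) (step fzero))
    where open LongCycleIn C

doubleEdges : ∀ {n} → SimpleGraph n → Multigraph n
doubleEdges G = record
  { mult     = λ u v → if adj u v then 2 else 0
  ; sym      = λ u v → cong (if_then 2 else 0) (sym u v)
  ; loopless = λ v → cong (if_then 2 else 0) (irrefl v)
  }
  where open SimpleGraph G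

module _ {n} (G : SimpleGraph n) where
  open SimpleGraph G using (adj)
  open Multigraph (doubleEdges G) using (mult)

  doubleEdges-edge⇒adj : ∀ {u v} → 0 < mult u v → adj u v ≡ true
  doubleEdges-edge⇒adj {u} {v} edge with adj u v
  ... | true  = refl
  ... | false = ⊥-elim (n≮n 0 edge)

  doubleEdges-planar : PlanarGraph G → PlanarMultigraph (doubleEdges G)
  doubleEdges-planar = PlanarRel-mono doubleEdges-edge⇒adj

  independent⇒edgeless : ∀ {S} → Independent G S → Edgeless (doubleEdges G) S
  independent⇒edgeless I {u} {v} u∈S v∈S rewrite I u v u∈S v∈S = refl

  inducedForest⇒independent : ∀ {S} → InducedForest (doubleEdges G) S → Independent G S
  inducedForest⇒independent (atMostOne , _) u v u∈S v∈S
    with adj u v | atMostOne u v u∈S v∈S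
  ... | false | _        = refl
  ... | true  | s≤s ()

  independent? : Decidable (Independent G)
  independent? S = all? λ u → all? λ v →
    (u ∈? S) →-dec ((v ∈? S) →-dec (adj u v ≟ᵇ false))

  ⊥-independent : Independent G ⊥
  ⊥-independent u v u∈⊥ _ = ⊥-elim (∉⊥ u∈⊥)

lemma3 : (n : ℕ) (G : SimpleGraph n) → PlanarGraph G →
    Σ (Multigraph n) λ M → PlanarMultigraph M ×
      Σ ℕ λ k → IsForestNumber M k × IsIndependenceNumber G k
lemma3 n G D with maximumSize-exists (independent? G) (⊥-independent G)
... | α , independenceNumber =
  doubleEdges G , doubleEdges-planar G D , α , forestNumber , independenceNumber
  where
  forestNumber : IsForestNumber (doubleEdges G) α
  forestNumber = IsMaximumSize-cong
    (edgeless⇒inducedForest ∘ independent⇒edgeless G)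
    (inducedForest⇒independent G)
    independenceNumber
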